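{- Let $H$ be an induced subgraph of a graph $G$ and let $L_1$ and $L_2$ be list assignments for $G$. Let $\vec{\delta}$ be an $(L_1,L_2)$-trajectory in $H$ witnessed by $(\sigma_1,\sigma_2)$. If $\vec{\delta}$ lifts to an $(L_1,L_2)$-trajectory $\vec{\varphi}$ in $G$, then this lifting is witnessed by a pair $(\pi_1,\pi_2)$ such that $\pi_1^H=\sigma_1$ and $\pi_2^H=\sigma_2$.
   Context: A list assignment $L$ for $G$ assigns to each vertex $v$ a set $L(v)$ of colors; an $L$-coloring is a proper coloring $\varphi$ with $\varphi(v)\in L(v)$ for all $v$. A sequence of recolorings of $G$ is a sequence $\sigma=(v_1,c_1),\ldots,(v_m,c_m)$ with $v_i\in V(G)$; applied to a coloring $\varphi$, it successively changes the color of $v_i$ to $c_i$, and $\varphi+\sigma$ denotes the resulting coloring. The sequence is proper (on $\varphi$) if all intermediate colorings (including the final one) are proper colorings of $G$. It is once-only if every vertex is recolored at most once. $+$ also denotes concatenation of sequences. For an induced subgraph $H$ of $G$, $\sigma^H$ is the subsequence of $\sigma$ consisting of the recolorings of vertices of $V(H)$; $\sigma$ is $H$-late if $\sigma=\sigma^{G-V(H)}+\sigma^H$. For list assignments $L_1,L_2$ for $G$, an $(L_1,L_2)$-trajectory in $G$ (starting with $\varphi_0$) is a triple $\vec{\varphi}=(\varphi_0,\varphi_1,\varphi_2)$ where $\varphi_0$ is a proper coloring of $G$ and, for $i\in\{1,2\}$, $\varphi_i$ is an $L_i$-coloring of $G$ obtained from $\varphi_{i-1}$ by a proper once-only sequence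 $\sigma_i$ of recolorings; $(\sigma_1,\sigma_2)$ is a witness of the trajectory. For an induced subgraph $H$ of $G$ and an $(L_1,L_2)$-trajectory $\vec{\delta}$ in $H$ (lists restricted to $H$), $\vec{\delta}$ lifts to an $(L_1,L_2)$-trajectory $\vec{\varphi}$ in $G$ if $\delta_i=\varphi_i\restriction V(H)$ for $i\in\{0,1,2\}$ and, for $i\in\{1,2\}$, there is a proper once-only $H$-late sequence $\sigma_i$ of recolorings transforming $\varphi_{i-1}$ into $\varphi_i$; such $(\sigma_1,\sigma_2)$ is a witness that $\vec{\delta}$ lifts to $\vec{\varphi}$. -}

module Defs where

open import Data.Nat using (ℕ)
open import Data.Fin using (Fin)
import Data.Fin.Properties as FinP
open import Data.Bool using (Bool; true; false; T)
open import Data.Unit using (tt)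
open import Data.Maybe using (Maybe; just; nothing)
open import Data.Product using (Σ; _×_; _,_; proj₁; proj₂)
open import Data.List using (List; []; _∷_; _++_)
open import Data.List.Relation.Unary.Unique.Propositional using (Unique)
open import Relation.Binary.PropositionalEquality using (_≡_; _≢_; refl)
open import Relation.Binary.Definitions using (DecidableEquality)
open import Relation.Nullary using (¬_; yes; no)
import Data.List as List

record Graph : Set₁ where
  field
    V    : Set
    _≟V_ : DecidableEquality V
    Adj  : V → V → Set

open Graph public

record SimpleGraph (n : ℕ) : Set₁ where
  field
    adj       : Fin n → Fin n → Set
    adj-sym   : ∀ {u v} → adj u v → adj v u
    adj-irref : ∀ {v} → ¬ adj v v

open SimpleGraph public

toGraph : ∀ {n} → SimpleGraph n → Graph
toGraph {n} G = record { V = Fin n ; _≟V_ = FinP._≟_ ; Adj = adj G }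

VH : ∀ {n} → (Fin n → Bool) → Set
VH {n} S = Σ (Fin n) (λ v → T (S v))

T-irr : ∀ b (p q : T b) → p ≡ q
T-irr true tt tt = refl

≟VH : ∀ {n} (S : Fin n → Bool) → DecidableEquality (VH S)
≟VH S (u , p) (v , q) with FinP._≟_ u v
≟VH S (u , p) (.u , q) | yes refl with T-irr (S u) p q
≟VH S (u , p) (.u , .p) | yes refl | refl = yes refl
≟VH S (u , p) (v , q) | no u≢v = no (λ { refl → u≢v refl })

induced : ∀ {n} → SimpleGraph n → (Fin n → Bool) → Graph
induced G S = record
  { V = VH S ; _≟V_ = ≟VH S ; Adj = λ u v → adj G (proj₁ u) (proj₁ v) }

module _ (Γ : Graph) where
  private
    W = V Γ
    _≟_ = _≟V_ Γ

  Coloring : Set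
  Coloring = W → ℕ

  ListAssignment : Set₁
  ListAssignment = W → ℕ → Set

  Proper : Coloring → Set
  Proper φ = ∀ u v → Adj Γ u v → φ u ≢ φ v

  IsLColoring : ListAssignment → Coloring → Set
  IsLColoring L φ = Proper φ × (∀ v → L v (φ v))

  Recoloring : Set
  Recoloring = List (W × ℕ)

  update : Coloring → W → ℕ → Coloring
  update φ v c w with w ≟ v
  ... | yes _ = c
  ... | no  _ = φ w

  apply : Coloring → Recoloring → Coloring
  apply φ [] = φ
  apply φ ((v , c) ∷ σ) = apply (update φ v c) σ

  ProperOn : Coloring → Recoloring → Set
  ProperOn φ [] = Proper φ
  ProperOn φ ((v , c) ∷ σ) = Proper φ × ProperOn (update φ v c) σ

  OnceOnly : Recoloring → Set
  OnceOnly σ = Unique (List.map proj₁ σ)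

  Transforms : Coloring → Coloring → Recoloring → Set
  Transforms φ ψ σ = ProperOn φ σ × OnceOnly σ × (∀ v → apply φ σ v ≡ ψ v)

  record Trajectory (L₁ L₂ : ListAssignment) : Set where
    field
      φ₀ φ₁ φ₂ : Coloring
      proper₀  : Proper φ₀
      isL₁     : IsLColoring L₁ φ₁
      isL₂     : IsLColoring L₂ φ₂

  open Trajectory public

  Witness : ∀ {L₁ L₂} → Trajectory L₁ L₂ → Recoloring → Recoloring → Set
  Witness t σ₁ σ₂ = Transforms (φ₀ t) (φ₁ t) σ₁ × Transforms (φ₁ t) (φ₂ t) σ₂

module _ {n : ℕ} (S : Fin n → Bool) where

  outside : List (Fin n × ℕ) → List (Fin n × ℕ)
  outside = List.filterᵇ (λ vc → Data.Bool.not (S (proj₁ vc)))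

  insideG : List (Fin n × ℕ) → List (Fin n × ℕ)
  insideG = List.filterᵇ (λ vc → S (proj₁ vc))

  toH : (v : Fin n) → (b : Bool) → S v ≡ b → Maybe (VH S)
  toH v true  eq = just (v , Relation.Binary.PropositionalEquality.subst T (Relation.Binary.PropositionalEquality.sym eq) tt)
  toH v false eq = nothing

  restrictH : List (Fin n × ℕ) → List (VH S × ℕ)
  restrictH [] = []
  restrictH ((v , c) ∷ σ) with toH v (S v) refl
  ... | just w  = (w , c) ∷ restrictH σ
  ... | nothing = restrictH σ

  HLate : List (Fin n × ℕ) → Set
  HLate σ = σ ≡ outside σ ++ insideG σ

module _ {n : ℕ} (G : SimpleGraph n) (S : Fin n → Bool) where
  private
    ΓG = toGraph G
    ΓH = induced G S

  restrictL : ListAssignment ΓG → ListAssignment ΓH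
  restrictL L w = L (proj₁ w)

  LiftWitness : {L₁ L₂ : ListAssignment ΓG}
              → Trajectory ΓH (restrictL L₁) (restrictL L₂)
              → Trajectory ΓG L₁ L₂
              → Recoloring ΓG → Recoloring ΓG → Set
  LiftWitness δ φ π₁ π₂ =
    (∀ w → φ₀ δ w ≡ φ₀ φ (proj₁ w)) ×
    (∀ w → φ₁ δ w ≡ φ₁ φ (proj₁ w)) ×
    (∀ w → φ₂ δ w ≡ φ₂ φ (proj₁ w)) ×
    (Transforms ΓG (φ₀ φ) (φ₁ φ) π₁ × HLate S π₁) ×
    (Transforms ΓG (φ₁ φ) (φ₂ φ) π₂ × HLate S π₂)

  Lifts : {L₁ L₂ : ListAssignment ΓG}
        → Trajectory ΓH (restrictL L₁) (restrictL L₂)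
        → Trajectory ΓG L₁ L₂ → Set
  Lifts δ φ = Σ (Recoloring ΓG) λ π₁ → Σ (Recoloring ΓG) λ π₂ → LiftWitness δ φ π₁ π₂

module Submission where

-- Replace the H-part of the H-late witness π by σ, i.e. use π^{G−V(H)} + σ. After
-- π^{G−V(H)} the vertices of H still have their initial colours and all other vertices their
-- final ones; this colouring χ is proper, being an intermediate colouring of π. While σ is
-- replayed, every vertex has either its χ-colour or (σ being once-only) its final colour,
-- and outside H these coincide. So an edge leaving H cannot become monochromatic, as χ and
-- the final colouring are proper, and edges inside H are taken care of by σ being proper.

open import Defs
open import Data.Nat using (ℕ)
open import Data.Fin using (Fin)
import Data.Fin.Properties as Fin
open import Data.Bool using (Bool; true; false; T; not)
open import Data.Empty using (⊥-elim)
open import Data.Product using (Σ; _×_; _,_; proj₁; proj₂; map₁)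
open import Data.Sum using (_⊎_; inj₁; inj₂)
import Data.Sum as Sum
open import Data.Maybe using (just; nothing)
open import Data.List using (List; []; _∷_; _++_; map; filter)
open import Data.List.Properties using (map-++; filter-++; filter-idem; filter-all; filter-none; ++-identityʳ)
open import Data.List.Relation.Unary.All as All using (All; []; _∷_)
import Data.List.Relation.Unary.All.Properties as All
open import Data.List.Relation.Unary.AllPairs as AllPairs using (_∷_)
import Data.List.Relation.Unary.AllPairs.Properties as AllPairs
open import Data.List.Relation.Unary.Unique.Propositional using (Unique)
import Data.List.Relation.Unary.Unique.Propositional.Properties as Unique
open import Data.List.Relation.Binary.Disjoint.Propositional using (Disjoint)
open import Function using (_∘_)
open import Relation.Binary.PropositionalEquality
open import Relation.Nullary using (¬_; yes; no)
open import Relation.Nullary.Decidable using (T?; toSum)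
open import Relation.Unary using (Pred; Decidable)

module _ (Γ : Graph) where

  update-≗ : ∀ {f g : Coloring Γ} → f ≗ g → ∀ v c → update Γ f v c ≗ update Γ g v c
  update-≗ f≗g v c x with _≟V_ Γ x v
  ... | yes _ = refl
  ... | no  _ = f≗g x

  update-≡ : ∀ (f : Coloring Γ) v c → update Γ f v c v ≡ c
  update-≡ f v c with _≟V_ Γ v v
  ... | yes _   = refl
  ... | no  v≢v = ⊥-elim (v≢v refl)

  update-≢ : ∀ (f : Coloring Γ) {v} c {x} → x ≢ v → update Γ f v c x ≡ f x
  update-≢ f {v} c {x} x≢v with _≟V_ Γ x v
  ... | yes x≡v = ⊥-elim (x≢v x≡v)
  ... | no  _   = refl

  apply-≗ : ∀ {f g : Coloring Γ} → f ≗ g → ∀ σ → apply Γ f σ ≗ apply Γ g σ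
  apply-≗ f≗g []            = f≗g
  apply-≗ f≗g ((v , c) ∷ σ) = apply-≗ (update-≗ f≗g v c) σ

  apply-++ : ∀ (f : Coloring Γ) xs ys → apply Γ f (xs ++ ys) ≡ apply Γ (apply Γ f xs) ys
  apply-++ f []            ys = refl
  apply-++ f ((v , c) ∷ xs) ys = apply-++ (update Γ f v c) xs ys

  apply-untouched : ∀ (f : Coloring Γ) σ {x} → All (x ≢_) (map proj₁ σ) → apply Γ f σ x ≡ f x
  apply-untouched f []            _              = refl
  apply-untouched f ((v , c) ∷ σ) (x≢v ∷ x∉σ) =
    trans (apply-untouched (update Γ f v c) σ x∉σ) (update-≢ f c x≢v)

  Proper-≗ : ∀ {f g : Coloring Γ} → f ≗ g → Proper Γ f → Proper Γ g
  Proper-≗ f≗g f-proper u v uv e = f-proper u v uv (trans (f≗g u) (trans e (sym (f≗g v))))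

  ProperOn-≗ : ∀ {f g : Coloring Γ} → f ≗ g → ∀ σ → ProperOn Γ f σ → ProperOn Γ g σ
  ProperOn-≗ f≗g []            f-proper       = Proper-≗ f≗g f-proper
  ProperOn-≗ f≗g ((v , c) ∷ σ) (f-proper , p) = Proper-≗ f≗g f-proper , ProperOn-≗ (update-≗ f≗g v c) σ p

  ProperOn⇒Proper-initial : ∀ f σ → ProperOn Γ f σ → Proper Γ f
  ProperOn⇒Proper-initial f []      p       = p
  ProperOn⇒Proper-initial f (_ ∷ _) (p , _) = p

  ProperOn⇒Proper-final : ∀ f σ → ProperOn Γ f σ → Proper Γ (apply Γ f σ)
  ProperOn⇒Proper-final f []            p       = p
  ProperOn⇒Proper-final f ((v , c) ∷ σ) (_ , p) = ProperOn⇒Proper-final (update Γ f v c) σ p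

  ProperOn-++⁻ : ∀ f xs ys → ProperOn Γ f (xs ++ ys) → ProperOn Γ f xs × ProperOn Γ (apply Γ f xs) ys
  ProperOn-++⁻ f []            ys p       = ProperOn⇒Proper-initial f ys p , p
  ProperOn-++⁻ f ((v , c) ∷ xs) ys (q , p) = map₁ (q ,_) (ProperOn-++⁻ (update Γ f v c) xs ys p)

  ProperOn-++⁺ : ∀ f xs ys → ProperOn Γ f xs → ProperOn Γ (apply Γ f xs) ys → ProperOn Γ f (xs ++ ys)
  ProperOn-++⁺ f []            ys _       q = q
  ProperOn-++⁺ f ((v , c) ∷ xs) ys (p , r) q = p , ProperOn-++⁺ (update Γ f v c) xs ys r q

  OnceOnly-filter : ∀ {p} {P : Pred (V Γ × ℕ) p} (P? : Decidable P) {σ} → OnceOnly Γ σ → OnceOnly Γ (filter P? σ)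
  OnceOnly-filter P? = AllPairs.map⁺ ∘ AllPairs.filter⁺ P? ∘ AllPairs.map⁻

  Transforms-≗ : ∀ {f f′ g g′ : Coloring Γ} {σ} → f ≗ f′ → g ≗ g′ → Transforms Γ f g σ → Transforms Γ f′ g′ σ
  Transforms-≗ {σ = σ} f≗f′ g≗g′ (p , once , fin) =
    ProperOn-≗ f≗f′ σ p , once , λ x → trans (sym (apply-≗ f≗f′ σ x)) (trans (fin x) (g≗g′ x))

  Transforms-++ : ∀ {f g h : Coloring Γ} {xs ys} → Disjoint (map proj₁ xs) (map proj₁ ys)
    → Transforms Γ f g xs → Transforms Γ g h ys → Transforms Γ f h (xs ++ ys)
  Transforms-++ {f} {g} {h} {xs} {ys} disjoint (p , once , fin) (q , once′ , fin′) =
    ProperOn-++⁺ f xs ys p (ProperOn-≗ (sym ∘ fin) ys q) ,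
    subst Unique (sym (map-++ proj₁ xs ys)) (Unique.++⁺ once once′ disjoint) ,
    λ x → begin
      apply Γ f (xs ++ ys) x       ≡⟨ cong (λ χ → χ x) (apply-++ f xs ys) ⟩
      apply Γ (apply Γ f xs) ys x  ≡⟨ apply-≗ fin ys x ⟩
      apply Γ g ys x               ≡⟨ fin′ x ⟩
      h x                          ∎
    where open ≡-Reasoning

  Between : Coloring Γ → Coloring Γ → Coloring Γ → Set
  Between χ ψ β = ∀ x → ψ x ≡ χ x ⊎ ψ x ≡ β x

  Between-≢ : ∀ {χ ψ β} → Proper Γ χ → Proper Γ β → Between χ ψ β
    → ∀ {u v} → Adj Γ u v → ψ u ≡ χ u × ψ u ≡ β u → ψ u ≢ ψ v
  Between-≢ {χ} {ψ} {β} χ-proper β-proper between {u} {v} uv (uχ , uβ) e with between v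
  ... | inj₁ vχ = χ-proper u v uv (trans (sym uχ) (trans e vχ))
  ... | inj₂ vβ = β-proper u v uv (trans (sym uβ) (trans e vβ))

T⇒¬T-not : ∀ {b} → T b → ¬ T (not b)
T⇒¬T-not {true} _ ()

T-not⇒¬T : ∀ {b} → T (not b) → ¬ T b
T-not⇒¬T t-not t = T⇒¬T-not t t-not

module _ {n : ℕ} (S : Fin n → Bool) where

  embed : List (VH S × ℕ) → List (Fin n × ℕ)
  embed = map (map₁ proj₁)

  VH-≡ : {x y : VH S} → proj₁ x ≡ proj₁ y → x ≡ y
  VH-≡ {u , p} {.u , q} refl = cong (u ,_) (T-irr (S u) p q)

  outside-≢ : ∀ {x y} → ¬ T (S x) → T (S y) → x ≢ y
  outside-≢ x∉ y∈ refl = x∉ y∈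

  embed-inside : ∀ σ → All (T ∘ S ∘ proj₁) (embed σ)
  embed-inside []            = []
  embed-inside ((w , _) ∷ σ) = proj₂ w ∷ embed-inside σ

  outside-outside : ∀ π → All (¬_ ∘ T ∘ S ∘ proj₁) (outside S π)
  outside-outside π = All.map T-not⇒¬T (All.all-filter _ π)

  outside-embed : ∀ σ → outside S (embed σ) ≡ []
  outside-embed σ = filter-none _ (All.map T⇒¬T-not (embed-inside σ))

  insideG-embed : ∀ σ → insideG S (embed σ) ≡ embed σ
  insideG-embed σ = filter-all _ (embed-inside σ)

  insideG-outside : ∀ π → insideG S (outside S π) ≡ []
  insideG-outside π = filter-none _ (outside-outside π)

  outside++embed-HLate : ∀ π σ → HLate S (outside S π ++ embed σ)
  outside++embed-HLate π σ = sym (begin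
    outside S (o ++ e) ++ insideG S (o ++ e)
      ≡⟨ cong₂ _++_ (filter-++ _ o e) (filter-++ _ o e) ⟩
    (outside S o ++ outside S e) ++ (insideG S o ++ insideG S e)
      ≡⟨ cong₂ _++_ (cong₂ _++_ (filter-idem _ π) (outside-embed σ)) (cong₂ _++_ (insideG-outside π) (insideG-embed σ)) ⟩
    (o ++ []) ++ e
      ≡⟨ cong (_++ e) (++-identityʳ o) ⟩
    o ++ e ∎)
    where
      open ≡-Reasoning
      o = outside S π
      e = embed σ

  restrictH-++ : ∀ xs ys → restrictH S (xs ++ ys) ≡ restrictH S xs ++ restrictH S ys
  restrictH-++ []            ys = refl
  restrictH-++ ((v , c) ∷ xs) ys with toH S v (S v) refl
  ... | just w  = cong ((w , c) ∷_) (restrictH-++ xs ys)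
  ... | nothing = restrictH-++ xs ys

  toH-outside : ∀ v b (eq : S v ≡ b) → ¬ T (S v) → toH S v b eq ≡ nothing
  toH-outside v true  eq v∉ = ⊥-elim (v∉ (subst T (sym eq) _))
  toH-outside v false _    _  = refl

  toH-inside : ∀ v b (eq : S v ≡ b) (v∈ : T (S v)) → toH S v b eq ≡ just (v , v∈)
  toH-inside v true  _ v∈ = cong (λ p → just (v , p)) (T-irr (S v) _ v∈)
  toH-inside v false eq v∈ = ⊥-elim (subst T eq v∈)

  restrictH-outside : ∀ π → All (¬_ ∘ T ∘ S ∘ proj₁) π → restrictH S π ≡ []
  restrictH-outside []            []          = refl
  restrictH-outside ((v , c) ∷ π) (v∉ ∷ π∉)
    with toH S v (S v) refl | toH-outside v (S v) refl v∉
  ... | .nothing | refl = restrictH-outside π π∉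

  restrictH-embed : ∀ σ → restrictH S (embed σ) ≡ σ
  restrictH-embed []                   = refl
  restrictH-embed (((v , v∈) , c) ∷ σ)
    with toH S v (S v) refl | toH-inside v (S v) refl v∈
  ... | .(just (v , v∈)) | refl = cong (((v , v∈) , c) ∷_) (restrictH-embed σ)

  restrictH-outside++embed : ∀ π σ → restrictH S (outside S π ++ embed σ) ≡ σ
  restrictH-outside++embed π σ = begin
    restrictH S (outside S π ++ embed σ)             ≡⟨ restrictH-++ (outside S π) (embed σ) ⟩
    restrictH S (outside S π) ++ restrictH S (embed σ) ≡⟨ cong₂ _++_ (restrictH-outside _ (outside-outside π)) (restrictH-embed σ) ⟩
    σ ∎
    where open ≡-Reasoning

module _ {n : ℕ} (G : SimpleGraph n) (S : Fin n → Bool) where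
  private
    ΓG = toGraph G
    ΓH = induced G S

  update-restrict : ∀ (f : Coloring ΓG) w c → update ΓG f (proj₁ w) c ∘ proj₁ ≗ update ΓH (f ∘ proj₁) w c
  update-restrict f w c y with ≟VH S y w
  ... | yes refl = update-≡ ΓG f (proj₁ y) c
  ... | no  y≢w  = update-≢ ΓG f c (y≢w ∘ VH-≡ S)

  apply-embed-inside : ∀ (f : Coloring ΓG) σ → apply ΓG f (embed S σ) ∘ proj₁ ≗ apply ΓH (f ∘ proj₁) σ
  apply-embed-inside f []            = λ _ → refl
  apply-embed-inside f ((w , c) ∷ σ) y =
    trans (apply-embed-inside (update ΓG f (proj₁ w) c) σ y) (apply-≗ ΓH (update-restrict f w c) σ y)

  apply-embed-outside : ∀ (f : Coloring ΓG) σ {x} → ¬ T (S x) → apply ΓG f (embed S σ) x ≡ f x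
  apply-embed-outside f σ x∉ =
    apply-untouched ΓG f (embed S σ) (All.map⁺ (All.map (outside-≢ S x∉) (embed-inside S σ)))

  OnceOnly-embed : ∀ σ → OnceOnly ΓH σ → OnceOnly ΓG (embed S σ)
  OnceOnly-embed σ = AllPairs.map⁺ ∘ AllPairs.map⁺ ∘ AllPairs.map (_∘ VH-≡ S) ∘ AllPairs.map⁻

  module _ {χ β : Coloring ΓG} (χ-proper : Proper ΓG χ) (β-proper : Proper ΓG β)
           (agree : ∀ {x} → ¬ T (S x) → χ x ≡ β x) where

    Between-outside : ∀ {ψ x} → Between ΓG χ ψ β → ¬ T (S x) → ψ x ≡ χ x × ψ x ≡ β x
    Between-outside {x = x} between x∉ with between x
    ... | inj₁ xχ = xχ , trans xχ (agree x∉)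
    ... | inj₂ xβ = trans xβ (sym (agree x∉)) , xβ

    Between⇒Proper : ∀ {ψ} → Between ΓG χ ψ β → Proper ΓH (ψ ∘ proj₁) → Proper ΓG ψ
    Between⇒Proper between ψH-proper u v uv with T? (S u) | T? (S v)
    ... | yes u∈ | yes v∈ = ψH-proper (u , u∈) (v , v∈) uv
    ... | no  u∉ | _      = Between-≢ ΓG χ-proper β-proper between uv (Between-outside between u∉)
    ... | yes _  | no  v∉ =
      Between-≢ ΓG χ-proper β-proper between (adj-sym G uv) (Between-outside between v∉) ∘ sym

    embed-ProperOn : ∀ {ψ} σ → Between ΓG χ ψ β → Transforms ΓH (ψ ∘ proj₁) (β ∘ proj₁) σ
      → ProperOn ΓG ψ (embed S σ)
    embed-ProperOn []            between (ψH-proper , _ , _) = Between⇒Proper between ψH-proper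
    embed-ProperOn {ψ} ((w , c) ∷ σ) between ((ψH-proper , p) , (w∉σ ∷ once) , fin) =
      Between⇒Proper between ψH-proper ,
      embed-ProperOn σ between′ (ProperOn-≗ ΓH (sym ∘ update-restrict ψ w c) σ p , once , fin′)
      where
        ψ′ : Coloring ΓG
        ψ′ = update ΓG ψ (proj₁ w) c
        fin′ : apply ΓH (ψ′ ∘ proj₁) σ ≗ β ∘ proj₁
        fin′ y = trans (apply-≗ ΓH (update-restrict ψ w c) σ y) (fin y)
        c≡β : c ≡ β (proj₁ w)
        c≡β = trans (sym (update-≡ ΓH (ψ ∘ proj₁) w c)) (trans (sym (apply-untouched ΓH _ σ w∉σ)) (fin w))
        between′ : Between ΓG χ ψ′ β
        between′ x with toSum (x Fin.≟ proj₁ w)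
        ... | inj₁ refl = inj₂ (trans (update-≡ ΓG ψ x c) c≡β)
        ... | inj₂ x≢w  = Sum.map (trans (update-≢ ΓG ψ c x≢w)) (trans (update-≢ ΓG ψ c x≢w)) (between x)

    embed-Transforms : ∀ σ → Transforms ΓH (χ ∘ proj₁) (β ∘ proj₁) σ → Transforms ΓG χ β (embed S σ)
    embed-Transforms σ t@(_ , once , fin) =
      embed-ProperOn σ (λ _ → inj₁ refl) t , OnceOnly-embed σ once , final
      where
        final : apply ΓG χ (embed S σ) ≗ β
        final x with T? (S x)
        ... | yes x∈ = trans (apply-embed-inside χ σ (x , x∈)) (fin (x , x∈))
        ... | no  x∉ = trans (apply-embed-outside χ σ x∉) (agree x∉)

  HLate-Transforms : ∀ {ψ₀ ψ₁ π σ} → Transforms ΓG ψ₀ ψ₁ π → HLate S π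
    → Transforms ΓH (ψ₀ ∘ proj₁) (ψ₁ ∘ proj₁) σ → Transforms ΓG ψ₀ ψ₁ (outside S π ++ embed S σ)
  HLate-Transforms {ψ₀} {ψ₁} {π} {σ} (p , once , fin) late t =
    Transforms-++ ΓG disjoint (proj₁ split , OnceOnly-filter ΓG _ once , λ _ → refl)
      (embed-Transforms χ-proper ψ₁-proper χ-outside σ (Transforms-≗ ΓH (sym ∘ χ-inside ∘ proj₂) (λ _ → refl) t))
    where
      o i : Recoloring ΓG
      o = outside S π
      i = insideG S π
      χ : Coloring ΓG
      χ = apply ΓG ψ₀ o
      split : ProperOn ΓG ψ₀ o × ProperOn ΓG χ i
      split = ProperOn-++⁻ ΓG ψ₀ o i (subst (ProperOn ΓG ψ₀) late p)
      χ-proper : Proper ΓG χ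
      χ-proper = ProperOn⇒Proper-initial ΓG χ i (proj₂ split)
      ψ₁-proper : Proper ΓG ψ₁
      ψ₁-proper = Proper-≗ ΓG fin (ProperOn⇒Proper-final ΓG ψ₀ π p)
      χ-inside : ∀ {x} → T (S x) → χ x ≡ ψ₀ x
      χ-inside x∈ = apply-untouched ΓG ψ₀ o
        (All.map⁺ (All.map (λ y∉ → outside-≢ S y∉ x∈ ∘ sym) (outside-outside S π)))
      χ-outside : ∀ {x} → ¬ T (S x) → χ x ≡ ψ₁ x
      χ-outside {x} x∉ = begin
        χ x                     ≡⟨ apply-untouched ΓG χ i (All.map⁺ (All.map (outside-≢ S x∉) (All.all-filter _ π))) ⟨
        apply ΓG χ i x          ≡⟨ cong (λ f → f x) (apply-++ ΓG ψ₀ o i) ⟨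
        apply ΓG ψ₀ (o ++ i) x  ≡⟨ cong (λ τ → apply ΓG ψ₀ τ x) late ⟨
        apply ΓG ψ₀ π x         ≡⟨ fin x ⟩
        ψ₁ x                    ∎
        where open ≡-Reasoning
      disjoint : Disjoint (map proj₁ o) (map proj₁ (embed S σ))
      disjoint (x∈o , x∈σ) =
        All.lookup (All.map⁺ (outside-outside S π)) x∈o (All.lookup (All.map⁺ (embed-inside S σ)) x∈σ)

mainTheorem5 : {n : ℕ} (G : SimpleGraph n) (S : Fin n → Bool)
    (L₁ L₂ : ListAssignment (toGraph G))
    (δ : Trajectory (induced G S) (restrictL G S L₁) (restrictL G S L₂))
    (σ₁ σ₂ : Recoloring (induced G S)) → Witness (induced G S) δ σ₁ σ₂
    → (φ : Trajectory (toGraph G) L₁ L₂) → Lifts G S δ φ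
    → Σ (Recoloring (toGraph G)) λ π₁ → Σ (Recoloring (toGraph G)) λ π₂ →
        LiftWitness G S δ φ π₁ π₂ × restrictH S π₁ ≡ σ₁ × restrictH S π₂ ≡ σ₂
mainTheorem5 G S _ _ _ σ₁ σ₂ (w₁ , w₂) _ (π₁ , π₂ , e₀ , e₁ , e₂ , (t₁ , l₁) , (t₂ , l₂)) =
  outside S π₁ ++ embed S σ₁ , outside S π₂ ++ embed S σ₂ ,
  (e₀ , e₁ , e₂ ,
    (HLate-Transforms G S t₁ l₁ (Transforms-≗ (induced G S) e₀ e₁ w₁) , outside++embed-HLate S π₁ σ₁) ,
    (HLate-Transforms G S t₂ l₂ (Transforms-≗ (induced G S) e₁ e₂ w₂) , outside++embed-HLate S π₂ σ₂)) ,
  restrictH-outside++embed S π₁ σ₁ , restrictH-outside++embed S π₂ σ₂
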